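{- Let $n\ge 1$ and let $\theta$ be a matching on $[2n]$ that avoids the pattern $12312$. Let $E_\theta=(j,2n)$ be the edge containing the node $2n$, suppose some edge of $\theta$ crosses $E_\theta$, and let the edge crossing $E_\theta$ with the rightmost end point have end point $j+m$ (so $m\ge1$). For each node $p$ let $E_p$ denote the edge of $\theta$ whose end point is $p$. Then for all $1\le r<s\le m$, $E_\theta$ is the only edge of $\theta$ that crosses both $E_{j+r}$ and $E_{j+s}$.
   Context: A matching on $[2n]$ is a partition of $[2n]$ into $n$ blocks of size two (edges); an edge is written $(i,j)$ with $i<j$, $i$ its initial point and $j$ its end point. Two edges $(i,j)$ and $(i',j')$ cross if $i<i'<j<j'$ or $i'<i<j'<j$. The canonical sequential form of a matching with $n$ edges is the word of length $2n$ obtained by labeling edges $1,\dots,n$ in increasing order of initial points and writing at each position the label of the edge containing it. Words $a_1\cdots a_k$, $b_1\cdots b_k$ are order-isomorphic if $a_i<a_j\iff b_i<b_j$ for all $i,j$. A matching contains a pattern $\tau$ if its canonical sequential form has a subsequence order-isomorphic to $\tau$, and avoids $\tau$ otherwise. -}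

module Defs where

open import Data.Nat using (ℕ; zero; suc; _*_; _+_; _∸_)
import Data.Nat as ℕ
open import Data.Fin using (Fin; toℕ; _<_; _≤_; _<?_; _≤?_)
import Data.Fin as F
open import Data.List using (List; length; filter; allFin)
open import Data.Vec using (Vec; lookup; _∷_; [])
open import Data.Product using (_×_; _,_; Σ; ∃)
open import Data.Sum using (_⊎_)
open import Data.Bool using (if_then_else_)
open import Relation.Nullary using (¬_)
open import Relation.Nullary.Decidable using (⌊_⌋; _×-dec_)
open import Relation.Binary.PropositionalEquality using (_≡_; _≢_)
open import Function.Bundles using (_⇔_)

-- A matching on [2n]: nodes are Fin (2 * n) (node i ↔ position i+1),
-- given by a fixed-point-free involution `partner`; edges are {i, partner i}.
record Matching (n : ℕ) : Set where
  field
    partner     : Fin (2 * n) → Fin (2 * n)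
    involutive  : ∀ i → partner (partner i) ≡ i
    noFixed     : ∀ i → partner i ≢ i
open Matching public

-- An edge is written as a pair (initial point, end point).
Edge : ℕ → Set
Edge n = Fin (2 * n) × Fin (2 * n)

IsEdge : ∀ {n} → Matching n → Fin (2 * n) → Fin (2 * n) → Set
IsEdge θ a b = a < b × partner θ a ≡ b

edgeOf : ∀ {n} → Matching n → Fin (2 * n) → Edge n
edgeOf θ p = if ⌊ p <? partner θ p ⌋ then (p , partner θ p) else (partner θ p , p)

Cross : ∀ {m} → Fin m × Fin m → Fin m × Fin m → Set
Cross (i , j) (i' , j') = (i < i' × i' < j × j < j') ⊎ (i' < i × i < j' × j' < j)

-- Canonical sequential form: the label of position p is the number of
-- initial points q (q < partner q) with q ≤ the initial point of p's edge.
label : ∀ {n} → Matching n → Fin (2 * n) → ℕ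
label {n} θ p with edgeOf θ p
... | (a , _) = length (filter (λ q → (q <? partner θ q) ×-dec (q ≤? a)) (allFin (2 * n)))

OrderIso : ∀ {k} → (Fin k → ℕ) → (Fin k → ℕ) → Set
OrderIso {k} a b = ∀ (i j : Fin k) → (a i ℕ.< a j) ⇔ (b i ℕ.< b j)

Contains : ∀ {n k} → Matching n → Vec ℕ k → Set
Contains {n} {k} θ τ =
  Σ (Fin k → Fin (2 * n)) λ f →
    (∀ (i j : Fin k) → i < j → f i < f j) ×
    OrderIso (λ i → label θ (f i)) (lookup τ)

Avoids : ∀ {n k} → Matching n → Vec ℕ k → Set
Avoids θ τ = ¬ Contains θ τ

p12312 : Vec ℕ 5
p12312 = 1 ∷ 2 ∷ 3 ∷ 1 ∷ 2 ∷ []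

lastNode : ∀ k → Fin (2 * suc k)
lastNode k = F.fromℕ (k + suc (k + 0))

-- Write E = (j, 2n) and let (a₀, c) be an edge crossing it, so a₀ < j < c < 2n.
-- Any initial point t with j < t < c would complete (a₀, c) and (j, 2n) to an
-- occurrence a₀ j t c 2n of 12312; hence every node in (j, c] is an end point,
-- and its partner, lying neither in (j, c) nor at j, lies left of j.  The edges
-- ending at two nodes p < q of (j, c] therefore both cross E, and an edge
-- crossing both of them other than E again yields a 12312 in each of the few
-- possible relative positions.
module Submission where

open import Defs
open import Data.Nat using (ℕ; suc; _∸_; _+_; _*_; s≤s)
import Data.Nat as ℕ
open import Data.Nat.Properties
  using (m≤n⇒m≤1+n; ≤-trans; <-irrefl; <-trans; <-≤-trans; <⇒≤; <⇒≱; m<m+n;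
         +-monoʳ-<; +-monoʳ-≤; m+[n∸m]≡n)
open import Data.Fin using (Fin; toℕ; zero; suc; inject₁; _<_; _≤_; _<?_; _≤?_)
import Data.Fin.Properties as Fin
open import Data.Product using (_×_; _,_; ∃)
open import Data.Sum using (_⊎_; inj₁; inj₂)
open import Data.Empty using (⊥-elim)
open import Data.List using ([]; _∷_; length; filter; allFin)
open import Data.List.Properties using (filter-accept; filter-reject)
open import Data.List.Membership.Propositional using (_∈_)
open import Data.List.Membership.Propositional.Properties using (∈-allFin)
open import Data.List.Relation.Unary.Any using (here; there)
open import Data.List.Relation.Binary.Sublist.Propositional using (⊆-refl)
open import Data.List.Relation.Binary.Sublist.Heterogeneous.Properties
  using (length-mono-≤; ⊆-filter-Sublist)
open import Data.Vec using (_∷_; []; lookup)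
open import Function using (_∘_)
open import Function.Bundles using (mk⇔)
open import Level using (0ℓ)
open import Relation.Nullary using (¬_; yes; no)
open import Relation.Nullary.Decidable using (_×-dec_)
open import Relation.Unary using (Pred; Decidable; _⊆_)
open import Relation.Binary using (Rel; Transitive; _Preserves_⟶_; tri<; tri≈; tri>)
open import Relation.Binary.PropositionalEquality
  using (_≡_; _≗_; refl; sym; trans; cong; subst)

module _ {A : Set} {P Q : Pred A 0ℓ} (P? : Decidable P) (Q? : Decidable Q) (P⊆Q : P ⊆ Q) where

  length-filter-mono : ∀ xs → length (filter P? xs) ℕ.≤ length (filter Q? xs)
  length-filter-mono xs =
    length-mono-≤ (⊆-filter-Sublist P? Q? {as = xs} (λ { refl → P⊆Q }) ⊆-refl)

  length-filter-mono-< : ∀ {y} xs → y ∈ xs → Q y → ¬ P y →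
                         length (filter P? xs) ℕ.< length (filter Q? xs)
  length-filter-mono-< (x ∷ xs) (here refl) Qx ¬Px
    rewrite filter-reject P? {xs = xs} ¬Px | filter-accept Q? {xs = xs} Qx =
      s≤s (length-filter-mono xs)
  length-filter-mono-< (x ∷ xs) (there y∈xs) Qy ¬Py with P? x | Q? x
  ... | yes _  | yes _  = s≤s (length-filter-mono-< xs y∈xs Qy ¬Py)
  ... | yes Px | no ¬Qx = ⊥-elim (¬Qx (P⊆Q Px))
  ... | no _   | yes _  = m≤n⇒m≤1+n (length-filter-mono-< xs y∈xs Qy ¬Py)
  ... | no _   | no _   = length-filter-mono-< xs y∈xs Qy ¬Py

module _ {a ℓ} {A : Set a} (_≺_ : Rel A ℓ) (≺-trans : Transitive _≺_) where

  preserves-<-from-steps : ∀ {k} (f : Fin (suc k) → A) → (∀ i → f (inject₁ i) ≺ f (suc i)) →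
                           f Preserves _<_ ⟶ _≺_
  preserves-<-from-steps {suc k} f step {zero} {suc zero} _ = step zero
  preserves-<-from-steps {suc k} f step {zero} {suc (suc j)} _ =
    ≺-trans (step zero)
            (preserves-<-from-steps (λ i → f (suc i)) (λ i → step (suc i)) {zero} {suc j} (s≤s ℕ.z≤n))
  preserves-<-from-steps {suc k} f step {suc i} {suc j} (s≤s i<j) =
    preserves-<-from-steps (λ i → f (suc i)) (λ i → step (suc i)) i<j

reflects-< : ∀ {k} {g : Fin k → ℕ} → g Preserves _<_ ⟶ ℕ._<_ → ∀ {x y} → g x ℕ.< g y → x < y
reflects-< g↑ {x} {y} gx<gy with Fin.<-cmp x y
... | tri< x<y _ _ = x<y
... | tri≈ _ refl _ = ⊥-elim (<-irrefl refl gx<gy)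
... | tri> _ _ y<x = ⊥-elim (<⇒≱ gx<gy (<⇒≤ (g↑ y<x)))

orderIso-factor : ∀ {m k} (v : Fin m → Fin k) {g h : Fin k → ℕ} {a b : Fin m → ℕ} →
                  g Preserves _<_ ⟶ ℕ._<_ → h Preserves _<_ ⟶ ℕ._<_ →
                  a ≗ g ∘ v → b ≗ h ∘ v → OrderIso a b
orderIso-factor v g↑ h↑ a≗gv b≗hv i j
  rewrite a≗gv i | a≗gv j | b≗hv i | b≗hv j = mk⇔ (h↑ ∘ reflects-< g↑) (g↑ ∘ reflects-< h↑)

offsets-between : ∀ {x c p q r s} → p ≡ x + r → q ≡ x + s → 1 ℕ.≤ r → r ℕ.< s → s ℕ.≤ c ∸ x →
                  x ℕ.≤ c → x ℕ.< p × p ℕ.< q × q ℕ.≤ c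
offsets-between {x} refl refl 1≤r r<s s≤c-x x≤c =
  m<m+n x 1≤r , +-monoʳ-< x r<s , subst (x + _ ℕ.≤_) (m+[n∸m]≡n x≤c) (+-monoʳ-≤ x s≤c-x)

module _ {n : ℕ} (θ : Matching n) where

  rank : Fin (2 * n) → ℕ
  rank a = length (filter (λ q → (q <? partner θ q) ×-dec (q ≤? a)) (allFin (2 * n)))

  rank-mono : ∀ {a b b'} → a < b → IsEdge θ b b' → rank a ℕ.< rank b
  rank-mono {a} {b} a<b (b<b' , refl) =
    length-filter-mono-< (λ q → (q <? partner θ q) ×-dec (q ≤? a))
                         (λ q → (q <? partner θ q) ×-dec (q ≤? b))
                         (λ (q<q' , q≤a) → q<q' , ≤-trans q≤a (<⇒≤ a<b))
                         (allFin (2 * n)) (∈-allFin b) (b<b' , Fin.≤-refl)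
                         (λ (_ , b≤a) → <⇒≱ a<b b≤a)

  end-unique : ∀ {a b b'} → IsEdge θ a b → IsEdge θ a b' → b ≡ b'
  end-unique (_ , refl) (_ , refl) = refl

  partner-injective : ∀ {p q} → partner θ p ≡ partner θ q → p ≡ q
  partner-injective {p} {q} p'≡q' =
    trans (sym (involutive θ p)) (trans (cong (partner θ) p'≡q') (involutive θ q))

  partner-of-end : ∀ {a b} → IsEdge θ a b → partner θ b ≡ a
  partner-of-end {a} (_ , refl) = involutive θ a

  end-edge : ∀ {t} → partner θ t < t → IsEdge θ (partner θ t) t
  end-edge {t} t'<t = t'<t , involutive θ t

  initial-or-end : ∀ t → t < partner θ t ⊎ partner θ t < t
  initial-or-end t with Fin.<-cmp t (partner θ t)
  ... | tri< t<t' _ _ = inj₁ t<t'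
  ... | tri≈ _ t≡t' _ = ⊥-elim (noFixed θ t (sym t≡t'))
  ... | tri> _ _ t'<t = inj₂ t'<t

  edgeOf-initial : ∀ {a b} → IsEdge θ a b → edgeOf θ a ≡ (a , b)
  edgeOf-initial {a} (a<b , refl) with a <? partner θ a
  ... | yes _   = refl
  ... | no a≮b = ⊥-elim (a≮b a<b)

  edgeOf-end : ∀ {a b} → IsEdge θ a b → edgeOf θ b ≡ (a , b)
  edgeOf-end {a} (a<b , refl) rewrite involutive θ a with partner θ a <? a
  ... | yes b<a = ⊥-elim (<⇒≱ a<b (<⇒≤ b<a))
  ... | no _    = refl

  label-initial : ∀ {a b} → IsEdge θ a b → label θ a ≡ rank a
  label-initial ab rewrite edgeOf-initial ab = refl

  label-end : ∀ {a b} → IsEdge θ a b → label θ b ≡ rank a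
  label-end ab rewrite edgeOf-end ab = refl

  contains-12312 : ∀ {a a' b b' c c'} → IsEdge θ a a' → IsEdge θ b b' → IsEdge θ c c' →
                   a < b → b < c → c < a' → a' < b' → Contains θ p12312
  contains-12312 {a} {a'} {b} {b'} {c} aa' bb' cc' a<b b<c c<a' a'<b' =
    position , (λ _ _ → position↑) , orderIso-factor value rank↑ suc↑ labels letters
    where
    position : Fin 5 → Fin (2 * n)
    position = lookup (a ∷ b ∷ c ∷ a' ∷ b' ∷ [])

    position↑ : position Preserves _<_ ⟶ _<_
    position↑ = preserves-<-from-steps _<_ Fin.<-trans position
      λ { zero → a<b ; (suc zero) → b<c ; (suc (suc zero)) → c<a' ; (suc (suc (suc zero))) → a'<b' }

    value : Fin 5 → Fin 3
    value = lookup (zero ∷ suc zero ∷ suc (suc zero) ∷ zero ∷ suc zero ∷ [])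

    rank↑ : lookup (rank a ∷ rank b ∷ rank c ∷ []) Preserves _<_ ⟶ ℕ._<_
    rank↑ = preserves-<-from-steps ℕ._<_ <-trans _
      λ { zero → rank-mono a<b bb' ; (suc zero) → rank-mono b<c cc' }

    suc↑ : (ℕ.suc ∘ toℕ) Preserves _<_ ⟶ ℕ._<_
    suc↑ = s≤s

    labels : (label θ ∘ position) ≗ lookup (rank a ∷ rank b ∷ rank c ∷ []) ∘ value
    labels zero                         = label-initial aa'
    labels (suc zero)                   = label-initial bb'
    labels (suc (suc zero))             = label-initial cc'
    labels (suc (suc (suc zero)))       = label-end aa'
    labels (suc (suc (suc (suc zero)))) = label-end bb'

    letters : lookup p12312 ≗ (ℕ.suc ∘ toℕ) ∘ value
    letters zero                         = refl
    letters (suc zero)                   = refl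
    letters (suc (suc zero))             = refl
    letters (suc (suc (suc zero)))       = refl
    letters (suc (suc (suc (suc zero)))) = refl

module LeftCrossing {n : ℕ} (θ : Matching n) (avoids : Avoids θ p12312) {a₀ c j l : Fin (2 * n)}
         (a₀c : IsEdge θ a₀ c) (jl : IsEdge θ j l) (a₀<j : a₀ < j) (j<c : j < c) (c<l : c < l) where

  no-edge-starts-between : ∀ {t t'} → j < t → t < c → ¬ IsEdge θ t t'
  no-edge-starts-between j<t t<c tt' = avoids (contains-12312 θ a₀c jl tt' a₀<j j<t t<c c<l)

  partner-left-of : ∀ {t} → j < t → t ≤ c → partner θ t < j
  partner-left-of {t} j<t t≤c with Fin.<-cmp t c
  ... | tri> _ _ c<t = ⊥-elim (<⇒≱ c<t t≤c)
  ... | tri≈ _ refl _ = subst (_< j) (sym (partner-of-end θ a₀c)) a₀<j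
  ... | tri< t<c _ _ with initial-or-end θ t
  ...   | inj₁ t<t' = ⊥-elim (no-edge-starts-between j<t t<c (t<t' , refl))
  ...   | inj₂ t'<t with Fin.<-cmp (partner θ t) j
  ...     | tri< t'<j _ _ = t'<j
  ...     | tri≈ _ refl _ =
    ⊥-elim (Fin.<-irrefl (end-unique θ (end-edge θ t'<t) jl) (<-trans t<c c<l))
  ...     | tri> _ _ j<t' =
    ⊥-elim (no-edge-starts-between j<t' (<-trans t'<t t<c) (end-edge θ t'<t))

  edge-ending-at : ∀ {t} → j < t → t ≤ c → IsEdge θ (partner θ t) t
  edge-ending-at j<t t≤c = end-edge θ (<-trans (partner-left-of j<t t≤c) j<t)

  crosses-edge-ending-at : ∀ {t} → j < t → t ≤ c → Cross (j , l) (edgeOf θ t)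
  crosses-edge-ending-at j<t t≤c rewrite edgeOf-end θ (edge-ending-at j<t t≤c) =
    inj₂ (partner-left-of j<t t≤c , j<t , <-≤-trans (s≤s t≤c) c<l)

  only-jl-crosses-both : ∀ {p q a b} → j < p → p < q → q ≤ c → IsEdge θ a b →
                         Cross (a , b) (edgeOf θ p) → Cross (a , b) (edgeOf θ q) → (a , b) ≡ (j , l)
  only-jl-crosses-both {p} {q} {a} {b} j<p p<q q≤c ab ab⋈p ab⋈q =
    cases (subst (Cross (a , b)) (edgeOf-end θ xp) ab⋈p)
          (subst (Cross (a , b)) (edgeOf-end θ yq) ab⋈q)
    where
    p≤c = <⇒≤ (<-≤-trans p<q q≤c)
    j<q = <-trans j<p p<q
    x = partner θ p
    y = partner θ q
    xp : IsEdge θ x p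
    xp = edge-ending-at j<p p≤c
    yq : IsEdge θ y q
    yq = edge-ending-at j<q q≤c
    x<j = partner-left-of j<p p≤c
    y<j = partner-left-of j<q q≤c
    absurd-12312 : ∀ {u u' v v' w w'} → IsEdge θ u u' → IsEdge θ v v' → IsEdge θ w w' →
                   u < v → v < w → w < u' → u' < v' → (a , b) ≡ (j , l)
    absurd-12312 uu' vv' ww' u<v v<w w<u' u'<v' =
      ⊥-elim (avoids (contains-12312 θ uu' vv' ww' u<v v<w w<u' u'<v'))
    cases : Cross (a , b) (x , p) → Cross (a , b) (y , q) → (a , b) ≡ (j , l)
    cases (inj₁ (_ , _ , b<p)) (inj₂ (_ , _ , q<b)) = ⊥-elim (Fin.<-asym p<q (<-trans q<b b<p))
    cases (inj₁ (a<x , x<b , b<p)) (inj₁ (a<y , y<b , b<q)) with Fin.<-cmp x y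
    ... | tri< x<y _ _ = absurd-12312 ab xp yq a<x x<y y<b b<p
    ... | tri≈ _ x≡y _ = ⊥-elim (Fin.<-irrefl (partner-injective θ x≡y) p<q)
    ... | tri> _ _ y<x = absurd-12312 ab yq xp a<y y<x x<b (<-trans b<p p<q)
    cases (inj₂ (x<a , a<p , p<b)) (inj₁ (a<y , y<b , b<q)) =
      absurd-12312 xp ab yq x<a a<y (<-trans y<j j<p) p<b
    cases (inj₂ (x<a , a<p , p<b)) (inj₂ (y<a , a<q , q<b)) with Fin.<-cmp a j
    ... | tri< a<j _ _ = absurd-12312 yq ab jl y<a a<j j<q q<b
    ... | tri≈ _ refl _ = cong (a ,_) (end-unique θ ab jl)
    ... | tri> _ _ j<a = ⊥-elim (no-edge-starts-between j<a (<-≤-trans a<p p≤c) ab)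

lastNode-edge : ∀ k (θ : Matching (suc k)) → IsEdge θ (partner θ (lastNode k)) (lastNode k)
lastNode-edge k θ =
  Fin.≤∧≢⇒< (Fin.≤fromℕ _) (noFixed θ (lastNode k)) , involutive θ (lastNode k)

cross-from-left : ∀ {m} {a b j l : Fin m} → Cross (a , b) (j , l) → b ≤ l → a < j × j < b × b < l
cross-from-left (inj₁ a<j<b<l) _ = a<j<b<l
cross-from-left (inj₂ (_ , _ , l<b)) b≤l = ⊥-elim (<⇒≱ l<b b≤l)

lemma2 : (k : ℕ) (θ : Matching (suc k)) → Avoids θ p12312 →
         (c : Fin (2 * suc k)) →
         (∃ λ a → IsEdge θ a c × Cross (a , c) (partner θ (lastNode k) , lastNode k)) →
         (∀ a b → IsEdge θ a b → Cross (a , b) (partner θ (lastNode k) , lastNode k) → toℕ b ℕ.≤ toℕ c) →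
         (r s : ℕ) → 1 ℕ.≤ r → r ℕ.< s → s ℕ.≤ toℕ c ∸ toℕ (partner θ (lastNode k)) →
         (p q : Fin (2 * suc k)) →
         toℕ p ≡ toℕ (partner θ (lastNode k)) + r →
         toℕ q ≡ toℕ (partner θ (lastNode k)) + s →
         Cross (partner θ (lastNode k) , lastNode k) (edgeOf θ p) ×
         Cross (partner θ (lastNode k) , lastNode k) (edgeOf θ q) ×
         (∀ a b → IsEdge θ a b → Cross (a , b) (edgeOf θ p) → Cross (a , b) (edgeOf θ q) →
            (a , b) ≡ (partner θ (lastNode k) , lastNode k))
lemma2 k θ avoids c (a₀ , a₀c , a₀c⋈E) _ r s 1≤r r<s s≤m p q p≡ q≡
  with cross-from-left a₀c⋈E (Fin.≤fromℕ c)
... | a₀<J , J<c , c<L with offsets-between p≡ q≡ 1≤r r<s s≤m (<⇒≤ J<c)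
... | J<p , p<q , q≤c =
  crosses-edge-ending-at J<p p≤c , crosses-edge-ending-at (<-trans J<p p<q) q≤c ,
  λ a b ab → only-jl-crosses-both J<p p<q q≤c ab
  where
  open LeftCrossing θ avoids a₀c (lastNode-edge k θ) a₀<J J<c c<L
  p≤c = <⇒≤ (<-≤-trans p<q q≤c)
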